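{- Let $F$ be a Boolean formula over $n$ variables, and let $m,\ell,u$ be positive integers with $m\le n$. If $\varphi_{Cells}^{\langle F,\ell,u\rangle}(m)$ is true, then $\ell\cdot 2^m\le\#F\le u\cdot 2^m$.
   Context: $\#F$ denotes the number of satisfying assignments of $F$ in $\{0,1\}^n$. $\mathcal{H}(n,m,n)$ is a fixed $n$-wise independent family of hash functions $\{0,1\}^n\to\{0,1\}^m$. Its members are specified by $n$ coefficients in $GF(2^{\max(n,m)})$, and $\exists h$ quantifies over these bits. Define $\varphi_{Cells}^{\langle F,\ell,u\rangle}(m)$ to be $$\exists h\in\mathcal{H}(n,m,n)\ \forall \alpha\in\{0,1\}^m,\ y_1,\dots,y_{u+1}\in\{0,1\}^n\ \exists z_1,\dots,z_\ell\in\{0,1\}^n$$ $$\Big[\Big(\bigwedge_{i=1}^{u+1}(F(y_i)\wedge h(y_i)=\alpha)\rightarrow\bigvee_{i=1}^{u}(y_{u+1}=y_i)\Big)\wedge\bigwedge_{i=1}^{\ell}(F(z_i)\wedge h(z_i)=\alpha)\wedge\bigwedge_{1\le i<j\le\ell}(z_i\neq z_j)\Big].$$ -}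

module Defs where

open import Data.Bool using (Bool; true; false; _∧_; _∨_; not)
open import Data.Nat using (ℕ; zero; suc; _⊔_; _*_; _^_; _<_)
open import Data.Fin using (Fin; fromℕ; inject₁) renaming (_<_ to _<ᶠ_)
open import Data.Vec using (Vec; []; _∷_; lookup)
import Data.Vec.Properties as VecP
open import Data.List using (List; []; _∷_; _++_; map; length; filter; concatMap)
open import Data.Product using (Σ; _×_; ∃; ∃-syntax)
open import Relation.Binary.PropositionalEquality using (_≡_; _≢_)
open import Relation.Nullary using (Dec; ¬_)
open import Data.Bool.Properties using () renaming (_≟_ to _≟ᵇ_)
open import Data.Fin.Properties using (all?)
open import Function.Definitions using (Injective)

BitVec : ℕ → Set
BitVec n = Vec Bool n

_≟ᵛ_ : ∀ {n} (x y : BitVec n) → Dec (x ≡ y)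
_≟ᵛ_ = VecP.≡-dec _≟ᵇ_

allBitVecs : (n : ℕ) → List (BitVec n)
allBitVecs zero = [] ∷ []
allBitVecs (suc n) = map (true ∷_) (allBitVecs n) ++ map (false ∷_) (allBitVecs n)

data Formula (n : ℕ) : Set where
  var  : Fin n → Formula n
  ⊤f   : Formula n
  ⊥f   : Formula n
  ¬f_  : Formula n → Formula n
  _∧f_ : Formula n → Formula n → Formula n
  _∨f_ : Formula n → Formula n → Formula n

eval : ∀ {n} → Formula n → BitVec n → Bool
eval (var i) σ = lookup σ i
eval ⊤f σ = true
eval ⊥f σ = false
eval (¬f F) σ = not (eval F σ)
eval (F ∧f G) σ = eval F σ ∧ eval G σ
eval (F ∨f G) σ = eval F σ ∨ eval G σ

#_ : ∀ {n} → Formula n → ℕ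
#_ {n} F = length (filter (λ σ → eval F σ ≟ᵇ true) (allBitVecs n))

-- Keys of the hash family H(n,m,n): n coefficients in GF(2^max(n,m)),
-- each given by its max(n,m) bits.
HashKey : ℕ → ℕ → Set
HashKey n m = Vec (BitVec (n ⊔ m)) n

allHashKeys : (n m : ℕ) → List (HashKey n m)
allHashKeys n m = go n
  where
  go : (k : ℕ) → List (Vec (BitVec (n ⊔ m)) k)
  go zero = [] ∷ []
  go (suc k) = concatMap (λ c → map (c ∷_) (go k)) (allBitVecs (n ⊔ m))

HashFamily : ℕ → ℕ → Set
HashFamily n m = HashKey n m → BitVec n → BitVec m

-- k-wise independence (uniform key): for every k pairwise distinct inputs
-- and every k outputs, Pr_h[∀ i. h(x_i) = α_i] = 2^(-m k), i.e.
-- #{h | ∀ i. h(x_i)=α_i} * 2^(m k) = #keys.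
IsKWiseIndependent : ∀ {n m} → ℕ → HashFamily n m → Set
IsKWiseIndependent {n} {m} k H =
  (xs : Fin k → BitVec n) → Injective _≡_ _≡_ xs →
  (αs : Fin k → BitVec m) →
  length (filter (λ h → all? (λ i → H h (xs i) ≟ᵛ αs i)) (allHashKeys n m)) * 2 ^ (m * k)
    ≡ length (allHashKeys n m)

φCells : ∀ {n m} → HashFamily n m → Formula n → ℕ → ℕ → Set
φCells {n} {m} H F ℓ u =
  Σ (HashKey n m) λ h → ((α : BitVec m) (ys : Fin (suc u) → BitVec n) →
    Σ (Fin ℓ → BitVec n) λ zs →
      ( (((i : Fin (suc u)) → (eval F (ys i) ≡ true) × (H h (ys i) ≡ α)) →
          Σ (Fin u) λ i → (ys (fromℕ u) ≡ ys (inject₁ i)))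
      × ((i : Fin ℓ) → (eval F (zs i) ≡ true) × (H h (zs i) ≡ α))
      × ((i j : Fin ℓ) → i <ᶠ j → zs i ≢ zs j)))

-- For a key h, the cells {σ | F σ, h σ = α}, α ∈ {0,1}^m, partition the
-- solutions of F, so #F is the sum of the 2^m cell sizes. The formula φCells
-- bounds every cell from below by ℓ (the ℓ distinct z's lie in it) and from
-- above by u (any u+1 members of a cell contain a repetition). Summing the
-- bounds over the cells gives ℓ 2^m ≤ #F ≤ u 2^m.
module Submission where

open import Defs
open import Algebra.Properties.CommutativeSemigroup as CSemigroupProperties using ()
open import Data.Bool using (true; false)
open import Data.Bool.Properties using () renaming (_≟_ to _≟ᵇ_)
open import Data.Fin as Fin using (Fin; fromℕ; inject₁; inject≤)
open import Data.Fin.Properties using (injective⇒≤; <-cmp; fromℕ≢inject₁; inject≤-injective)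
open import Data.List using (List; []; _∷_; [_]; _++_; map; length; filter; lookup)
open import Data.List.Membership.Propositional using (_∈_; _∉_)
open import Data.List.Membership.Propositional.Properties
  using (∈-map⁺; ∈-map⁻; ∈-++⁺ˡ; ∈-++⁺ʳ; ∈-filter⁺; ∈-filter⁻; ∈-lookup)
open import Data.List.Membership.Setoid.Properties using (index-injective)
open import Data.List.Properties using (length-++; length-map; filter-++; map-cong)
open import Data.List.Relation.Unary.All as All using ([])
open import Data.List.Relation.Unary.AllPairs using ([]; _∷_)
open import Data.List.Relation.Unary.Any using (here; there; index)
open import Data.List.Relation.Unary.Unique.Propositional using (Unique)
import Data.List.Relation.Unary.Unique.Propositional.Properties as Unique
open import Data.Nat using (ℕ; zero; suc; _+_; _*_; _^_; _≤_; _<_; z≤n; NonZero)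
open import Data.Nat.ListAction using (sum)
open import Data.Nat.Properties
  using (+-mono-≤; +-identityʳ; *-comm; *-zeroʳ; ≮⇒≥; +-commutativeSemigroup; module ≤-Reasoning)
open import Data.Product using (∃; _×_; _,_; proj₁; proj₂)
open import Data.Vec using (Vec; []; _∷_; replicate)
open import Function using (_∘_)
open import Function.Definitions using (Injective)
open import Relation.Binary.Definitions using (DecidableEquality; tri<; tri≈; tri>)
open import Relation.Binary.PropositionalEquality
  using (_≡_; _≢_; refl; sym; trans; cong; cong₂; setoid; module ≡-Reasoning)
open import Relation.Nullary using (yes; no; ¬_; contradiction)

open CSemigroupProperties +-commutativeSemigroup using (interchange)

∈-allBitVecs : ∀ {n} (v : BitVec n) → v ∈ allBitVecs n
∈-allBitVecs [] = here refl
∈-allBitVecs {suc n} (true ∷ v) = ∈-++⁺ˡ (∈-map⁺ (true ∷_) (∈-allBitVecs v))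
∈-allBitVecs {suc n} (false ∷ v) =
  ∈-++⁺ʳ (map (true ∷_) (allBitVecs n)) (∈-map⁺ (false ∷_) (∈-allBitVecs v))

unique-allBitVecs : ∀ n → Unique (allBitVecs n)
unique-allBitVecs zero = [] ∷ []
unique-allBitVecs (suc n) =
  Unique.++⁺ (Unique.map⁺ ∷-injectiveʳ (unique-allBitVecs n))
             (Unique.map⁺ ∷-injectiveʳ (unique-allBitVecs n))
             disjoint
  where
  ∷-injectiveʳ : ∀ {b} {x y : BitVec n} → Vec._∷_ b x ≡ b ∷ y → x ≡ y
  ∷-injectiveʳ refl = refl

  disjoint : ∀ {v} → ¬ (v ∈ map (true ∷_) (allBitVecs n) × v ∈ map (false ∷_) (allBitVecs n))
  disjoint (p , q) with ∈-map⁻ (true ∷_) p | ∈-map⁻ (false ∷_) q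
  ... | _ , _ , refl | _ , _ , ()

length-allBitVecs : ∀ n → length (allBitVecs n) ≡ 2 ^ n
length-allBitVecs zero = refl
length-allBitVecs (suc n) = begin
  length (map (true ∷_) (allBitVecs n) ++ map (false ∷_) (allBitVecs n))
    ≡⟨ length-++ (map (true ∷_) (allBitVecs n)) ⟩
  length (map (true ∷_) (allBitVecs n)) + length (map (false ∷_) (allBitVecs n))
    ≡⟨ cong₂ _+_ (length-map (true ∷_) (allBitVecs n)) (length-map (false ∷_) (allBitVecs n)) ⟩
  length (allBitVecs n) + length (allBitVecs n)
    ≡⟨ cong (λ k → k + k) (length-allBitVecs n) ⟩
  2 ^ n + 2 ^ n
    ≡⟨ cong (2 ^ n +_) (sym (+-identityʳ (2 ^ n))) ⟩
  2 ^ suc n ∎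
  where open ≡-Reasoning

module _ {A : Set} where

  sum-map-+ : (f g : A → ℕ) (xs : List A) →
              sum (map (λ a → f a + g a) xs) ≡ sum (map f xs) + sum (map g xs)
  sum-map-+ f g [] = refl
  sum-map-+ f g (x ∷ xs) =
    trans (cong (f x + g x +_) (sum-map-+ f g xs))
          (interchange (f x) (g x) (sum (map f xs)) (sum (map g xs)))

  sum-map-const : (c : ℕ) (xs : List A) → sum (map (λ _ → c) xs) ≡ length xs * c
  sum-map-const c [] = refl
  sum-map-const c (x ∷ xs) = cong (c +_) (sum-map-const c xs)

  sum-map-mono : {f g : A → ℕ} → (∀ a → f a ≤ g a) → (xs : List A) →
                 sum (map f xs) ≤ sum (map g xs)
  sum-map-mono f≤g [] = z≤n
  sum-map-mono f≤g (x ∷ xs) = +-mono-≤ (f≤g x) (sum-map-mono f≤g xs)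

  lookup-injective : {xs : List A} → Unique xs → Injective _≡_ _≡_ (lookup xs)
  lookup-injective {_ ∷ _} _ {Fin.zero} {Fin.zero} _ = refl
  lookup-injective {_ ∷ _} (x≢xs ∷ _) {Fin.zero} {Fin.suc j} eq =
    contradiction eq (All.lookup x≢xs (∈-lookup j))
  lookup-injective {_ ∷ _} (x≢xs ∷ _) {Fin.suc i} {Fin.zero} eq =
    contradiction (sym eq) (All.lookup x≢xs (∈-lookup i))
  lookup-injective {_ ∷ _} (_ ∷ u) {Fin.suc i} {Fin.suc j} eq = cong Fin.suc (lookup-injective u eq)

  distinct-members⇒≤length : ∀ {ℓ} {xs : List A} (zs : Fin ℓ → A) →
    (∀ i j → i Fin.< j → zs i ≢ zs j) → (∀ i → zs i ∈ xs) → ℓ ≤ length xs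
  distinct-members⇒≤length zs distinct zs∈xs = injective⇒≤ index-injective′
    where
    index-injective′ : Injective _≡_ _≡_ (λ i → index (zs∈xs i))
    index-injective′ {i} {j} eq with index-injective (setoid A) (zs∈xs i) (zs∈xs j) eq | <-cmp i j
    ... | zsi≡zsj | tri< i<j _ _ = contradiction zsi≡zsj (distinct i j i<j)
    ... | _       | tri≈ _ i≡j _ = i≡j
    ... | zsi≡zsj | tri> _ _ j<i = contradiction (sym zsi≡zsj) (distinct j i j<i)

  -- Were xs longer than u, its first u+1 entries would be a repetition-free
  -- family of members.
  repeating-members⇒length≤ : ∀ {u} {xs : List A} → Unique xs →
    (∀ (ys : Fin (suc u) → A) → (∀ i → ys i ∈ xs) → ∃ λ i → ys (fromℕ u) ≡ ys (inject₁ i)) →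
    length xs ≤ u
  repeating-members⇒length≤ {u} {xs} unique repeats = ≮⇒≥ longer-absurd
    where
    longer-absurd : ¬ u < length xs
    longer-absurd u<len
      with repeats (λ i → lookup xs (inject≤ i u<len)) (λ i → ∈-lookup (inject≤ i u<len))
    ... | i , eq = fromℕ≢inject₁ (inject≤-injective u<len u<len _ _ (lookup-injective unique eq))

module Fibres {A B : Set} (_≟_ : DecidableEquality B) (key : A → B) where

  fibre : B → List A → List A
  fibre β = filter (λ a → key a ≟ β)

  private
    sum-length-fibres-singleton-∉ : ∀ a βs → key a ∉ βs →
      sum (map (λ β → length (fibre β [ a ])) βs) ≡ 0
    sum-length-fibres-singleton-∉ a [] _ = refl
    sum-length-fibres-singleton-∉ a (β ∷ βs) key∉ with key a ≟ β
    ... | yes key≡β = contradiction (here key≡β) key∉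
    ... | no _ = sum-length-fibres-singleton-∉ a βs (key∉ ∘ there)

    sum-length-fibres-singleton-∈ : ∀ a {βs} → Unique βs → key a ∈ βs →
      sum (map (λ β → length (fibre β [ a ])) βs) ≡ 1
    sum-length-fibres-singleton-∈ a {β ∷ βs} (β∉βs ∷ unique) key∈ with key a ≟ β | key∈
    ... | yes refl | _ =
      cong suc (sum-length-fibres-singleton-∉ a βs λ key∈βs → All.lookup β∉βs key∈βs refl)
    ... | no key≢β | here key≡β = contradiction key≡β key≢β
    ... | no _     | there key∈βs = sum-length-fibres-singleton-∈ a unique key∈βs

  sum-length-fibres : {βs : List B} → Unique βs → (∀ a → key a ∈ βs) →
    (xs : List A) → sum (map (λ β → length (fibre β xs)) βs) ≡ length xs
  sum-length-fibres {βs} _ _ [] = trans (sum-map-const 0 βs) (*-zeroʳ (length βs))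
  sum-length-fibres {βs} unique covers (a ∷ xs) = begin
    sum (map (λ β → length (fibre β ([ a ] ++ xs))) βs)
      ≡⟨ cong sum (map-cong length-fibre-++ βs) ⟩
    sum (map (λ β → length (fibre β [ a ]) + length (fibre β xs)) βs)
      ≡⟨ sum-map-+ (λ β → length (fibre β [ a ])) (λ β → length (fibre β xs)) βs ⟩
    sum (map (λ β → length (fibre β [ a ])) βs) + sum (map (λ β → length (fibre β xs)) βs)
      ≡⟨ cong₂ _+_ (sum-length-fibres-singleton-∈ a unique (covers a))
                   (sum-length-fibres unique covers xs) ⟩
    suc (length xs) ∎
    where
    open ≡-Reasoning
    length-fibre-++ : ∀ β →
      length (fibre β ([ a ] ++ xs)) ≡ length (fibre β [ a ]) + length (fibre β xs)
    length-fibre-++ β =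
      trans (cong length (filter-++ (λ a → key a ≟ β) [ a ] xs)) (length-++ (fibre β [ a ]))

module Cells {n m} (F : Formula n) (hash : BitVec n → BitVec m) where

  solutions : List (BitVec n)
  solutions = filter (λ σ → eval F σ ≟ᵇ true) (allBitVecs n)

  open Fibres _≟ᵛ_ hash

  cell : BitVec m → List (BitVec n)
  cell α = fibre α solutions

  ∈-cell⁺ : ∀ {σ α} → (eval F σ ≡ true) × (hash σ ≡ α) → σ ∈ cell α
  ∈-cell⁺ {σ} {α} (Fσ , hσ≡α) =
    ∈-filter⁺ (λ τ → hash τ ≟ᵛ α) (∈-filter⁺ (λ τ → eval F τ ≟ᵇ true) (∈-allBitVecs σ) Fσ) hσ≡α

  ∈-cell⁻ : ∀ {σ α} → σ ∈ cell α → (eval F σ ≡ true) × (hash σ ≡ α)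
  ∈-cell⁻ {α = α} σ∈cell with ∈-filter⁻ (λ τ → hash τ ≟ᵛ α) σ∈cell
  ... | σ∈solutions , hσ≡α =
    proj₂ (∈-filter⁻ (λ τ → eval F τ ≟ᵇ true) {xs = allBitVecs n} σ∈solutions) , hσ≡α

  unique-cell : ∀ α → Unique (cell α)
  unique-cell α =
    Unique.filter⁺ (λ τ → hash τ ≟ᵛ α) (Unique.filter⁺ (λ τ → eval F τ ≟ᵇ true) (unique-allBitVecs n))

  sum-length-cells : sum (map (λ α → length (cell α)) (allBitVecs m)) ≡ # F
  sum-length-cells =
    sum-length-fibres (unique-allBitVecs m) (λ σ → ∈-allBitVecs (hash σ)) solutions

sum-map-const-allBitVecs : ∀ m c → sum (map (λ _ → c) (allBitVecs m)) ≡ c * 2 ^ m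
sum-map-const-allBitVecs m c =
  trans (sum-map-const c (allBitVecs m)) (trans (cong (_* c) (length-allBitVecs m)) (*-comm (2 ^ m) c))

proposition4p1 : (n m ℓ u : ℕ) → .{{NonZero m}} → .{{NonZero ℓ}} → .{{NonZero u}} →
    m ≤ n → (H : HashFamily n m) → IsKWiseIndependent n H →
    (F : Formula n) → φCells H F ℓ u →
    (ℓ * 2 ^ m ≤ # F) × (# F ≤ u * 2 ^ m)
proposition4p1 n m ℓ u _ H _ F (h , φ) = lower , upper
  where
  open Cells F (H h)
  open ≤-Reasoning

  -- The ys only matter for the upper bound, so any family serves here.
  ℓ≤cell : ∀ α → ℓ ≤ length (cell α)
  ℓ≤cell α with φ α (λ _ → replicate n false)
  ... | zs , _ , zs∈cell , zs-distinct =
    distinct-members⇒≤length zs zs-distinct (∈-cell⁺ ∘ zs∈cell)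

  cell≤u : ∀ α → length (cell α) ≤ u
  cell≤u α = repeating-members⇒length≤ (unique-cell α)
    (λ ys ys∈cell → proj₁ (proj₂ (φ α ys)) (∈-cell⁻ ∘ ys∈cell))

  lower : ℓ * 2 ^ m ≤ # F
  lower = begin
    ℓ * 2 ^ m                                          ≡⟨ sum-map-const-allBitVecs m ℓ ⟨
    sum (map (λ _ → ℓ) (allBitVecs m))                 ≤⟨ sum-map-mono ℓ≤cell (allBitVecs m) ⟩
    sum (map (λ α → length (cell α)) (allBitVecs m))   ≡⟨ sum-length-cells ⟩
    # F                                                ∎

  upper : # F ≤ u * 2 ^ m
  upper = begin
    # F                                                ≡⟨ sum-length-cells ⟨
    sum (map (λ α → length (cell α)) (allBitVecs m))   ≤⟨ sum-map-mono cell≤u (allBitVecs m) ⟩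
    sum (map (λ _ → u) (allBitVecs m))                 ≡⟨ sum-map-const-allBitVecs m u ⟩
    u * 2 ^ m                                          ∎
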